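{- Let $A_0 \in \{ -1,0,1\}^{m_0\times n_0}$ be an EQ matrix. For integers $k\ge 1$ define recursively \[ A_k = \begin{bmatrix} A_{k-1} & A_{k-1} & I_{m_{k-1}} \\ A_{k-1} & -A_{k-1} & 0 \end{bmatrix}, \] where $A_{k-1}$ has size $m_{k-1}\times n_{k-1}$, $I_{m_{k-1}}$ is the $m_{k-1}\times m_{k-1}$ identity matrix and $0$ is the $m_{k-1}\times m_{k-1}$ zero matrix. Then for every integer $k\ge 0$, $A_k$ is an EQ matrix (with entries in $\{ -1,0,1\}$) of size $m_k\times n_k$, where $m_k = 2^k m_0$ and $n_k = 2^k n_0\left(\frac{k}{2}\frac{m_0}{n_0}+1\right)$.
   Context: A matrix $A\in\mathbb{Z}^{m\times n}$ is called an EQ matrix if the homogeneous system $Ax=0$ has no non-trivial solution $x\in\{ -1,0,1\}^n$ (i.e., the only solution in $\{ -1,0,1\}^n$ is $x=0$). -}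

module Defs where

open import Data.Nat using (ℕ; zero; suc; _+_; _*_; _^_)
open import Data.Fin using (Fin; splitAt; _≟_)
open import Data.Sum using (_⊎_; inj₁; inj₂)
open import Data.Integer using (ℤ; 0ℤ; 1ℤ; -_) renaming (_*_ to _*ℤ_)
open import Data.Integer.Properties using ()
open import Relation.Binary.PropositionalEquality using (_≡_)
open import Relation.Nullary using (yes; no)
open import Data.Vec.Functional using (Vector; foldr)
import Data.Integer as ℤ

Matrix : ℕ → ℕ → Set
Matrix m n = Fin m → Fin n → ℤ

Ternary : ℤ → Set
Ternary t = (t ≡ - 1ℤ) ⊎ (t ≡ 0ℤ) ⊎ (t ≡ 1ℤ)

sumℤ : ∀ {n} → Vector ℤ n → ℤ
sumℤ = foldr ℤ._+_ 0ℤ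

mulVec : ∀ {m n} → Matrix m n → Vector ℤ n → Vector ℤ m
mulVec A x i = sumℤ (λ j → A i j *ℤ x j)

TernaryMatrix : ∀ {m n} → Matrix m n → Set
TernaryMatrix {m} {n} A = ∀ (i : Fin m) (j : Fin n) → Ternary (A i j)

IsEQ : ∀ {m n} → Matrix m n → Set
IsEQ {m} {n} A =
  ∀ (x : Vector ℤ n) → (∀ j → Ternary (x j)) →
  (∀ i → mulVec A x i ≡ 0ℤ) → ∀ j → x j ≡ 0ℤ

identity : ∀ {m} → Matrix m m
identity i j with i ≟ j
... | yes _ = 1ℤ
... | no _ = 0ℤ

-- the block matrix [ A  A  I ; A  -A  0 ]
step : ∀ {m n} → Matrix m n → Matrix (m + m) ((n + n) + m)
step {m} {n} A r c with splitAt m r | splitAt (n + n) c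
... | inj₁ i | inj₁ c' with splitAt n c'
...   | inj₁ j = A i j
...   | inj₂ j = A i j
step {m} {n} A r c | inj₁ i | inj₂ j = identity i j
step {m} {n} A r c | inj₂ i | inj₁ c' with splitAt n c'
...   | inj₁ j = A i j
...   | inj₂ j = - (A i j)
step {m} {n} A r c | inj₂ i | inj₂ j = 0ℤ

rows : ℕ → ℕ → ℕ → ℕ
rows m₀ n₀ zero = m₀
rows m₀ n₀ (suc k) = rows m₀ n₀ k + rows m₀ n₀ k

cols : ℕ → ℕ → ℕ → ℕ
cols m₀ n₀ zero = n₀
cols m₀ n₀ (suc k) = (cols m₀ n₀ k + cols m₀ n₀ k) + rows m₀ n₀ k

seqA : ∀ {m₀ n₀} → Matrix m₀ n₀ → (k : ℕ) → Matrix (rows m₀ n₀ k) (cols m₀ n₀ k)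
seqA A₀ zero = A₀
seqA A₀ (suc k) = step (seqA A₀ k)

{-# OPTIONS --safe #-}
-- Write x = (u, v, w) along the column blocks of A_{k+1}. The two row blocks
-- of A_{k+1} x = 0 read  A u + A v + w = 0  and  A u − A v = 0, so
-- 2 A u = −w. Since w ∈ {−1,0,1}^m, parity forces w = 0 and A u = A v = 0,
-- and the EQ property of A gives u = v = 0.
module Submission where

open import Defs
open import Data.Nat using (ℕ; _+_; _*_; _^_; zero; suc)
import Data.Nat.Properties as ℕ
open import Data.Product using (_×_; _,_; proj₁; proj₂)
open import Data.Sum using (inj₁; inj₂)
open import Data.Fin using (Fin; zero; suc; _↑ˡ_; _↑ʳ_; splitAt; join; punchIn; _≟_)
open import Data.Fin.Properties using (splitAt-↑ˡ; splitAt-↑ʳ; join-splitAt; punchInᵢ≢i)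
open import Data.Integer using (ℤ; 0ℤ; 1ℤ; -_; +_; -[1+_]; _-_) renaming (_+_ to _+ℤ_; _*_ to _*ℤ_)
open import Data.Integer.Properties as ℤ
  using (+-0-commutativeMonoid; +-0-abelianGroup; i-j≡0⇒i≡j; neg-distrib-+; neg-distribˡ-*)
open import Data.Vec.Functional using (Vector)
open import Relation.Binary.PropositionalEquality
open import Relation.Nullary using (yes; no)
open import Data.Empty using (⊥-elim)
open import Data.Nat.Tactic.RingSolver using (solve-∀)

open import Algebra.Properties.CommutativeMonoid.Sum +-0-commutativeMonoid
  using (sum-cong-≗; sum-replicate-zero; sum-remove)
open import Algebra.Properties.AbelianGroup +-0-abelianGroup using (inverseˡ-unique; inverseʳ-unique)

↑ˡ-↑ʳ-elim : ∀ {m n} {P : Fin (m + n) → Set} →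
  (∀ i → P (i ↑ˡ n)) → (∀ j → P (m ↑ʳ j)) → ∀ k → P k
↑ˡ-↑ʳ-elim {m} {n} {P} left right k = subst P (join-splitAt m n k) (by-block (splitAt m k))
  where
  by-block : ∀ s → P (join m n s)
  by-block (inj₁ i) = left i
  by-block (inj₂ j) = right j

sum-↑ˡ-↑ʳ : ∀ m {n} (f : Vector ℤ (m + n)) →
  sumℤ f ≡ sumℤ (λ i → f (i ↑ˡ n)) +ℤ sumℤ (λ j → f (m ↑ʳ j))
sum-↑ˡ-↑ʳ zero    f = sym (ℤ.+-identityˡ _)
sum-↑ˡ-↑ʳ (suc m) f = trans (cong (f zero +ℤ_) (sum-↑ˡ-↑ʳ m (λ i → f (suc i))))
                             (sym (ℤ.+-assoc (f zero) _ _))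

sum-neg : ∀ {n} (f : Vector ℤ n) → sumℤ (λ j → - f j) ≡ - sumℤ f
sum-neg {zero}  f = refl
sum-neg {suc n} f = trans (cong (- f zero +ℤ_) (sum-neg (λ j → f (suc j))))
                          (sym (neg-distrib-+ (f zero) _))

sum-zero : ∀ {n} (f : Vector ℤ n) → (∀ j → f j ≡ 0ℤ) → sumℤ f ≡ 0ℤ
sum-zero {n} f f≡0 = trans (sum-cong-≗ f≡0) (sum-replicate-zero n)

mulVec-identity : ∀ {m} (w : Vector ℤ m) i → mulVec identity w i ≡ w i
mulVec-identity {suc m} w i = begin
  mulVec identity w i                                  ≡⟨ sum-remove {i = i} (λ j → identity i j *ℤ w j) ⟩
  identity i i *ℤ w i +ℤ sumℤ (λ j → identity i (punchIn i j) *ℤ w (punchIn i j))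
                                                       ≡⟨ cong₂ _+ℤ_ (cong (_*ℤ w i) identity-diagonal) off-diagonal≡0 ⟩
  1ℤ *ℤ w i +ℤ 0ℤ                                      ≡⟨ ℤ.+-identityʳ _ ⟩
  1ℤ *ℤ w i                                            ≡⟨ ℤ.*-identityˡ _ ⟩
  w i                                                  ∎
  where
  open ≡-Reasoning
  identity-diagonal : identity i i ≡ 1ℤ
  identity-diagonal with i ≟ i
  ... | yes _   = refl
  ... | no i≢i = ⊥-elim (i≢i refl)
  identity-off : ∀ {j} → j ≢ i → identity i j ≡ 0ℤ
  identity-off {j} j≢i with i ≟ j
  ... | yes i≡j = ⊥-elim (j≢i (sym i≡j))
  ... | no _    = refl
  off-diagonal≡0 : sumℤ (λ j → identity i (punchIn i j) *ℤ w (punchIn i j)) ≡ 0ℤ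
  off-diagonal≡0 = sum-zero _ (λ j → cong (_*ℤ w (punchIn i j)) (identity-off (punchInᵢ≢i i j)))

module _ {m n : ℕ} (A : Matrix m n) where

  step-top-left : ∀ i j → step A (i ↑ˡ m) ((j ↑ˡ n) ↑ˡ m) ≡ A i j
  step-top-left i j rewrite splitAt-↑ˡ m i m | splitAt-↑ˡ (n + n) (j ↑ˡ n) m | splitAt-↑ˡ n j n = refl

  step-top-middle : ∀ i j → step A (i ↑ˡ m) ((n ↑ʳ j) ↑ˡ m) ≡ A i j
  step-top-middle i j rewrite splitAt-↑ˡ m i m | splitAt-↑ˡ (n + n) (n ↑ʳ j) m | splitAt-↑ʳ n n j = refl

  step-top-right : ∀ i j → step A (i ↑ˡ m) ((n + n) ↑ʳ j) ≡ identity i j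
  step-top-right i j rewrite splitAt-↑ˡ m i m | splitAt-↑ʳ (n + n) m j = refl

  step-bottom-left : ∀ i j → step A (m ↑ʳ i) ((j ↑ˡ n) ↑ˡ m) ≡ A i j
  step-bottom-left i j rewrite splitAt-↑ʳ m m i | splitAt-↑ˡ (n + n) (j ↑ˡ n) m | splitAt-↑ˡ n j n = refl

  step-bottom-middle : ∀ i j → step A (m ↑ʳ i) ((n ↑ʳ j) ↑ˡ m) ≡ - A i j
  step-bottom-middle i j rewrite splitAt-↑ʳ m m i | splitAt-↑ˡ (n + n) (n ↑ʳ j) m | splitAt-↑ʳ n n j = refl

  step-bottom-right : ∀ i j → step A (m ↑ʳ i) ((n + n) ↑ʳ j) ≡ 0ℤ
  step-bottom-right i j rewrite splitAt-↑ʳ m m i | splitAt-↑ʳ (n + n) m j = refl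

  module _ (x : Vector ℤ ((n + n) + m)) where

    left middle : Vector ℤ n
    left   j = x ((j ↑ˡ n) ↑ˡ m)
    middle j = x ((n ↑ʳ j) ↑ˡ m)

    right : Vector ℤ m
    right j = x ((n + n) ↑ʳ j)

    mulVec-by-blocks : ∀ {r} (B : Matrix r ((n + n) + m)) i → mulVec B x i ≡
      (sumℤ (λ j → B i ((j ↑ˡ n) ↑ˡ m) *ℤ left j) +ℤ sumℤ (λ j → B i ((n ↑ʳ j) ↑ˡ m) *ℤ middle j))
      +ℤ sumℤ (λ j → B i ((n + n) ↑ʳ j) *ℤ right j)
    mulVec-by-blocks B i = trans (sum-↑ˡ-↑ʳ (n + n) _)
      (cong (_+ℤ sumℤ (λ j → B i ((n + n) ↑ʳ j) *ℤ right j)) (sum-↑ˡ-↑ʳ n _))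

    mulVec-step-top : ∀ i →
      mulVec (step A) x (i ↑ˡ m) ≡ (mulVec A left i +ℤ mulVec A middle i) +ℤ right i
    mulVec-step-top i = trans (mulVec-by-blocks (step A) (i ↑ˡ m)) (cong₂ _+ℤ_
      (cong₂ _+ℤ_ (sum-cong-≗ (λ j → cong (_*ℤ left j) (step-top-left i j)))
                  (sum-cong-≗ (λ j → cong (_*ℤ middle j) (step-top-middle i j))))
      (trans (sum-cong-≗ (λ j → cong (_*ℤ right j) (step-top-right i j))) (mulVec-identity right i)))

    mulVec-step-bottom : ∀ i →
      mulVec (step A) x (m ↑ʳ i) ≡ mulVec A left i - mulVec A middle i
    mulVec-step-bottom i = trans (mulVec-by-blocks (step A) (m ↑ʳ i)) (trans (cong₂ _+ℤ_
      (cong₂ _+ℤ_ (sum-cong-≗ (λ j → cong (_*ℤ left j) (step-bottom-left i j)))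
                  (trans (sum-cong-≗ (λ j → trans (cong (_*ℤ middle j) (step-bottom-middle i j))
                                                  (sym (neg-distribˡ-* (A i j) (middle j)))))
                         (sum-neg (λ j → A i j *ℤ middle j))))
      (sum-zero _ (λ j → cong (_*ℤ right j) (step-bottom-right i j))))
      (ℤ.+-identityʳ _))

Ternary-neg : ∀ {t} → Ternary t → Ternary (- t)
Ternary-neg (inj₁ refl)        = inj₂ (inj₂ refl)
Ternary-neg (inj₂ (inj₁ refl)) = inj₂ (inj₁ refl)
Ternary-neg (inj₂ (inj₂ refl)) = inj₁ refl

double≡ternary⇒0 : ∀ a {t} → Ternary t → a +ℤ a ≡ t → a ≡ 0ℤ
double≡ternary⇒0 (+ n)              (inj₁ refl)        ()
double≡ternary⇒0 -[1+ n ]           (inj₁ refl)        ()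
double≡ternary⇒0 (+ zero)           (inj₂ (inj₁ refl)) _  = refl
double≡ternary⇒0 (+ suc n)          (inj₂ (inj₁ refl)) ()
double≡ternary⇒0 -[1+ n ]           (inj₂ (inj₁ refl)) ()
double≡ternary⇒0 (+ zero)           (inj₂ (inj₂ refl)) ()
double≡ternary⇒0 (+ suc zero)       (inj₂ (inj₂ refl)) ()
double≡ternary⇒0 (+ suc (suc n))    (inj₂ (inj₂ refl)) ()
double≡ternary⇒0 -[1+ n ]           (inj₂ (inj₂ refl)) ()

double+ternary≡0 : ∀ a {w} → Ternary w → (a +ℤ a) +ℤ w ≡ 0ℤ → a ≡ 0ℤ × w ≡ 0ℤ
double+ternary≡0 a {w} w-ternary 2a+w≡0 = a≡0 , w≡0
  where
  a≡0 : a ≡ 0ℤ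
  a≡0 = double≡ternary⇒0 a (Ternary-neg w-ternary) (inverseˡ-unique (a +ℤ a) w 2a+w≡0)
  w≡0 : w ≡ 0ℤ
  w≡0 = trans (inverseʳ-unique (a +ℤ a) w 2a+w≡0) (cong (λ b → - (b +ℤ b)) a≡0)

step-preserves-IsEQ : ∀ {m n} (A : Matrix m n) → IsEQ A → IsEQ (step A)
step-preserves-IsEQ {m} {n} A A-EQ x x-ternary Ax≡0 =
  ↑ˡ-↑ʳ-elim {P = λ c → x c ≡ 0ℤ}
    (↑ˡ-↑ʳ-elim {P = λ c → x (c ↑ˡ m) ≡ 0ℤ}
      (A-EQ u (λ j → x-ternary _) (λ i → proj₁ (top-solved i)))
      (A-EQ v (λ j → x-ternary _) (λ i → trans (sym (Au≡Av i)) (proj₁ (top-solved i)))))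
    (λ i → proj₂ (top-solved i))
  where
  u v : Vector ℤ n
  u = left A x
  v = middle A x
  Au≡Av : ∀ i → mulVec A u i ≡ mulVec A v i
  Au≡Av i = i-j≡0⇒i≡j _ _ (trans (sym (mulVec-step-bottom A x i)) (Ax≡0 (m ↑ʳ i)))
  top-solved : ∀ i → mulVec A u i ≡ 0ℤ × right A x i ≡ 0ℤ
  top-solved i = double+ternary≡0 _ (x-ternary _) (begin
    (mulVec A u i +ℤ mulVec A u i) +ℤ right A x i ≡⟨ cong (λ b → (mulVec A u i +ℤ b) +ℤ right A x i) (Au≡Av i) ⟩
    (mulVec A u i +ℤ mulVec A v i) +ℤ right A x i ≡⟨ mulVec-step-top A x i ⟨
    mulVec (step A) x (i ↑ˡ m)                    ≡⟨ Ax≡0 (i ↑ˡ m) ⟩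
    0ℤ                                            ∎)
    where open ≡-Reasoning

Ternary-identity : ∀ {m} (i j : Fin m) → Ternary (identity i j)
Ternary-identity i j with i ≟ j
... | yes _ = inj₂ (inj₂ refl)
... | no _  = inj₂ (inj₁ refl)

step-preserves-TernaryMatrix : ∀ {m n} (A : Matrix m n) → TernaryMatrix A → TernaryMatrix (step A)
step-preserves-TernaryMatrix {m} {n} A A-ternary r c with splitAt m r | splitAt (n + n) c
... | inj₁ i | inj₁ c′ with splitAt n c′
...   | inj₁ j = A-ternary i j
...   | inj₂ j = A-ternary i j
step-preserves-TernaryMatrix A A-ternary r c | inj₁ i | inj₂ j = Ternary-identity i j
step-preserves-TernaryMatrix {n = n} A A-ternary r c | inj₂ i | inj₁ c′ with splitAt n c′
...   | inj₁ j = A-ternary i j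
...   | inj₂ j = Ternary-neg (A-ternary i j)
step-preserves-TernaryMatrix A A-ternary r c | inj₂ i | inj₂ j = inj₂ (inj₁ refl)

rows≡2^k*m₀ : ∀ m₀ n₀ k → rows m₀ n₀ k ≡ 2 ^ k * m₀
rows≡2^k*m₀ m₀ n₀ zero    = sym (ℕ.+-identityʳ m₀)
rows≡2^k*m₀ m₀ n₀ (suc k) = trans (cong (λ r → r + r) (rows≡2^k*m₀ m₀ n₀ k)) (doubling (2 ^ k) m₀)
  where
  doubling : ∀ p m → p * m + p * m ≡ (2 * p) * m
  doubling = solve-∀

2*cols≡2^k*[k*m₀+2*n₀] : ∀ m₀ n₀ k → 2 * cols m₀ n₀ k ≡ 2 ^ k * (k * m₀ + 2 * n₀)
2*cols≡2^k*[k*m₀+2*n₀] m₀ n₀ zero    = sym (ℕ.+-identityʳ (2 * n₀))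
2*cols≡2^k*[k*m₀+2*n₀] m₀ n₀ (suc k) = begin
  2 * ((c + c) + r)                                      ≡⟨ expand c r ⟩
  2 * (2 * c) + 2 * r                                    ≡⟨ cong₂ (λ a b → 2 * a + 2 * b) (2*cols≡2^k*[k*m₀+2*n₀] m₀ n₀ k) (rows≡2^k*m₀ m₀ n₀ k) ⟩
  2 * (2 ^ k * (k * m₀ + 2 * n₀)) + 2 * (2 ^ k * m₀)     ≡⟨ collect (2 ^ k) k m₀ n₀ ⟩
  2 ^ suc k * (suc k * m₀ + 2 * n₀)                      ∎
  where
  open ≡-Reasoning
  c r : ℕ
  c = cols m₀ n₀ k
  r = rows m₀ n₀ k
  expand : ∀ c r → 2 * ((c + c) + r) ≡ 2 * (2 * c) + 2 * r
  expand = solve-∀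
  collect : ∀ p k m n → 2 * (p * (k * m + 2 * n)) + 2 * (p * m) ≡ (2 * p) * (suc k * m + 2 * n)
  collect = solve-∀

theorem1 : ∀ (m₀ n₀ : ℕ) (A₀ : Matrix m₀ n₀) →
    TernaryMatrix A₀ → IsEQ A₀ →
    ∀ (k : ℕ) →
      IsEQ (seqA A₀ k) × TernaryMatrix (seqA A₀ k) ×
      rows m₀ n₀ k ≡ 2 ^ k * m₀ ×
      2 * cols m₀ n₀ k ≡ 2 ^ k * (k * m₀ + 2 * n₀)
theorem1 m₀ n₀ A₀ A₀-ternary A₀-EQ k =
  seqA-IsEQ k , seqA-TernaryMatrix k , rows≡2^k*m₀ m₀ n₀ k , 2*cols≡2^k*[k*m₀+2*n₀] m₀ n₀ k
  where
  seqA-IsEQ : ∀ k → IsEQ (seqA A₀ k)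
  seqA-IsEQ zero    = A₀-EQ
  seqA-IsEQ (suc k) = step-preserves-IsEQ (seqA A₀ k) (seqA-IsEQ k)
  seqA-TernaryMatrix : ∀ k → TernaryMatrix (seqA A₀ k)
  seqA-TernaryMatrix zero    = A₀-ternary
  seqA-TernaryMatrix (suc k) = step-preserves-TernaryMatrix (seqA A₀ k) (seqA-TernaryMatrix k)
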